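{- For all integers $x \geq 3$ and $V \geq 2$, put $W = V^{x+2} - 1$ and $A = W^{x+2}$, $B = W^{x+1}$, $C = W^{x} V$. Then $A^{x} + B^{x+1} = C^{x+2}$, $\gcd(A,B,C) = W^{x} > 1$, and $\min(A,B,C)/\gcd(A,B,C) = V$. Consequently, the quantity $\min(A,B,C)/\gcd(A,B,C)$ over all solutions of $A^x + B^y = C^z$ with $x,y,z \geq 3$ and $A,B,C \geq 1$ has no maximal value.
   Context: For a solution of $A^x + B^y = C^z$ in positive integers $A,B,C$ with integer exponents $x,y,z \geq 3$, its Pegg Value is $\min(A,B,C)/\gcd(A,B,C)$. -}

module Defs where

open import Data.Nat using (ℕ; zero; suc; _+_; _*_; _^_; _≤_; _<_; _⊓_)
open import Data.Nat.DivMod using (_/_)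
open import Data.Nat.GCD using (gcd)
open import Data.Product using (_×_)
open import Relation.Binary.PropositionalEquality using (_≡_)

gcd3 : ℕ → ℕ → ℕ → ℕ
gcd3 A B C = gcd (gcd A B) C

min3 : ℕ → ℕ → ℕ → ℕ
min3 A B C = (A ⊓ B) ⊓ C

-- total natural-number division (m / 0 := 0); only used with a nonzero divisor
_div_ : ℕ → ℕ → ℕ
m div zero = zero
m div suc n = m / suc n

peggValue : ℕ → ℕ → ℕ → ℕ
peggValue A B C = min3 A B C div gcd3 A B C

IsSolution : ℕ → ℕ → ℕ → ℕ → ℕ → ℕ → Set
IsSolution A B C x y z =
  (1 ≤ A × 1 ≤ B × 1 ≤ C) × (3 ≤ x × 3 ≤ y × 3 ≤ z) × (A ^ x + B ^ y ≡ C ^ z)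

{-# OPTIONS --safe #-}
module Submission where

-- With W = V ^ (x + 2) ∸ 1 we have 1 + W = V ^ (x + 2), and since (x + 1)² = x (x + 2) + 1,
--   A ^ x + B ^ (x + 1) = W ^ (x (x + 2)) (1 + W) = (W ^ x) ^ (x + 2) V ^ (x + 2) = C ^ (x + 2).
-- Every common divisor of W and V divides 1 + W − W, so gcd W V = 1 and the gcd of
-- (W ^ x W², W ^ x W, W ^ x V) is W ^ x. As V < W, the minimum is C = W ^ x V, and the
-- Pegg value is V, which is arbitrarily large.

open import Defs
open import Data.Nat using (ℕ; zero; suc; _+_; _*_; _^_; _∸_; _≤_; _<_; _⊓_; NonZero; ≢-nonZero; z≤n; s≤s; s≤s⁻¹)
open import Data.Nat.Properties
open import Data.Nat.Divisibility using (_∣_; ∣-antisym; ∣-refl; ∣-trans; ∣m+n∣m⇒∣n; ∣1⇒≡1; m∣m*n; ∣n⇒∣m*n)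
open import Data.Nat.DivMod using (_/_; m*n/n≡m)
open import Data.Nat.GCD using (gcd; gcd[m,n]∣m; gcd[m,n]∣n; gcd-greatest; c*gcd[m,n]≡gcd[cm,cn])
open import Data.Nat.Tactic.RingSolver using (solve-∀)
open import Data.Product using (_×_; ∃-syntax; _,_)
open import Relation.Binary.PropositionalEquality using (_≡_; refl; sym; trans; cong; cong₂; subst; module ≡-Reasoning)

^-distribʳ-* : ∀ m n o → (m * n) ^ o ≡ m ^ o * n ^ o
^-distribʳ-* m n zero    = refl
^-distribʳ-* m n (suc o) = begin
  m * n * (m * n) ^ o      ≡⟨ cong (m * n *_) (^-distribʳ-* m n o) ⟩
  m * n * (m ^ o * n ^ o)  ≡⟨ [m*n]*[o*p]≡[m*o]*[n*p] m n (m ^ o) (n ^ o) ⟩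
  m ^ suc o * n ^ suc o    ∎
  where open ≡-Reasoning

m^[n+1]≡m^n*m : ∀ m n → m ^ (n + 1) ≡ m ^ n * m
m^[n+1]≡m^n*m m n = trans (^-distribˡ-+-* m n 1) (cong (m ^ n *_) (*-identityʳ m))

m^[n+2]≡m^n*[m*m] : ∀ m n → m ^ (n + 2) ≡ m ^ n * (m * m)
m^[n+2]≡m^n*[m*m] m n = trans (^-distribˡ-+-* m n 2) (cong (λ t → m ^ n * (m * t)) (*-identityʳ m))

[n+1]²≡1+[n+2]*n : ∀ n → (n + 1) * (n + 1) ≡ suc ((n + 2) * n)
[n+1]²≡1+[n+2]*n = solve-∀

pegg-equation : ∀ x V W → suc W ≡ V ^ (x + 2) →
  (W ^ (x + 2)) ^ x + (W ^ (x + 1)) ^ (x + 1) ≡ (W ^ x * V) ^ (x + 2)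
pegg-equation x V W 1+W≡V^[x+2] = begin
  (W ^ (x + 2)) ^ x + (W ^ (x + 1)) ^ (x + 1)
    ≡⟨ cong₂ _+_ (^-*-assoc W (x + 2) x) (^-*-assoc W (x + 1) (x + 1)) ⟩
  W ^ e + W ^ ((x + 1) * (x + 1))
    ≡⟨ cong (λ k → W ^ e + W ^ k) ([n+1]²≡1+[n+2]*n x) ⟩
  suc W * W ^ e
    ≡⟨ cong₂ _*_ 1+W≡V^[x+2] (cong (W ^_) (*-comm (x + 2) x)) ⟩
  V ^ (x + 2) * W ^ (x * (x + 2))
    ≡⟨ cong (V ^ (x + 2) *_) (sym (^-*-assoc W x (x + 2))) ⟩
  V ^ (x + 2) * (W ^ x) ^ (x + 2)
    ≡⟨ *-comm (V ^ (x + 2)) ((W ^ x) ^ (x + 2)) ⟩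
  (W ^ x) ^ (x + 2) * V ^ (x + 2)
    ≡⟨ sym (^-distribʳ-* (W ^ x) V (x + 2)) ⟩
  (W ^ x * V) ^ (x + 2) ∎
  where
  open ≡-Reasoning
  e : ℕ
  e = (x + 2) * x

n∣1+m⇒gcd[m,n]≡1 : ∀ {m n} → n ∣ suc m → gcd m n ≡ 1
n∣1+m⇒gcd[m,n]≡1 {m} {n} n∣1+m = ∣1⇒≡1 (∣m+n∣m⇒∣n gcd∣m+1 (gcd[m,n]∣m m n))
  where
  gcd∣m+1 : gcd m n ∣ m + 1
  gcd∣m+1 = subst (gcd m n ∣_) (+-comm 1 m) (∣-trans (gcd[m,n]∣n m n) n∣1+m)

n∣m⇒gcd[m,n]≡n : ∀ {m n} → n ∣ m → gcd m n ≡ n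
n∣m⇒gcd[m,n]≡n {m} {n} n∣m = ∣-antisym (gcd[m,n]∣n m n) (gcd-greatest n∣m ∣-refl)

gcd3[c*m²,c*m,c*n]≡c : ∀ c m n → gcd m n ≡ 1 → gcd3 (c * (m * m)) (c * m) (c * n) ≡ c
gcd3[c*m²,c*m,c*n]≡c c m n gcd[m,n]≡1 = begin
  gcd (gcd (c * (m * m)) (c * m)) (c * n)  ≡⟨ cong (λ g → gcd g (c * n)) (sym (c*gcd[m,n]≡gcd[cm,cn] c (m * m) m)) ⟩
  gcd (c * gcd (m * m) m) (c * n)          ≡⟨ sym (c*gcd[m,n]≡gcd[cm,cn] c (gcd (m * m) m) n) ⟩
  c * gcd (gcd (m * m) m) n                ≡⟨ cong (λ g → c * gcd g n) (n∣m⇒gcd[m,n]≡n {m * m} {m} (m∣m*n m)) ⟩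
  c * gcd m n                              ≡⟨ cong (c *_) gcd[m,n]≡1 ⟩
  c * 1                                    ≡⟨ *-identityʳ c ⟩
  c                                        ∎
  where open ≡-Reasoning

min3-of-decreasing : ∀ {a b c} → b ≤ a → c ≤ b → min3 a b c ≡ c
min3-of-decreasing {a} {b} {c} b≤a c≤b = trans (cong (_⊓ c) (m≥n⇒m⊓n≡n b≤a)) (m≥n⇒m⊓n≡n c≤b)

[m*n]div[m]≡n : ∀ m n .{{_ : NonZero m}} → (m * n) div m ≡ n
[m*n]div[m]≡n m@(suc _) n = trans (cong (_/ m) (*-comm m n)) (m*n/n≡m n m)

2+m≤m^[n+2] : ∀ {m} n → 2 ≤ m → 2 + m ≤ m ^ (n + 2)
2+m≤m^[n+2] {m@(suc _)} n 2≤m = begin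
  2 + m        ≤⟨ +-monoˡ-≤ m 2≤m ⟩
  m + m        ≡⟨ cong (m +_) (sym (+-identityʳ m)) ⟩
  2 * m        ≤⟨ *-monoˡ-≤ m 2≤m ⟩
  m * m        ≡⟨ cong (m *_) (sym (*-identityʳ m)) ⟩
  m ^ 2        ≤⟨ ^-monoʳ-≤ m (m≤n+m 2 n) ⟩
  m ^ (n + 2)  ∎
  where open ≤-Reasoning

m∣m^[n+2] : ∀ m n → m ∣ m ^ (n + 2)
m∣m^[n+2] m n = subst (m ∣_) (sym (m^[n+2]≡m^n*[m*m] m n)) (∣n⇒∣m*n (m ^ n) (m∣m*n m))

1+W≡V^[n+2]⇒V<W : ∀ n {V W} → 2 ≤ V → suc W ≡ V ^ (n + 2) → V < W
1+W≡V^[n+2]⇒V<W n {V} 2≤V 1+W≡V^[n+2] = s≤s⁻¹ (subst (2 + V ≤_) (sym 1+W≡V^[n+2]) (2+m≤m^[n+2] n 2≤V))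

pegg-gcd : ∀ x V W → suc W ≡ V ^ (x + 2) → gcd3 (W ^ (x + 2)) (W ^ (x + 1)) (W ^ x * V) ≡ W ^ x
pegg-gcd x V W 1+W≡V^[x+2] = begin
  gcd3 (W ^ (x + 2)) (W ^ (x + 1)) (W ^ x * V)
    ≡⟨ cong₂ (λ a b → gcd3 a b (W ^ x * V)) (m^[n+2]≡m^n*[m*m] W x) (m^[n+1]≡m^n*m W x) ⟩
  gcd3 (W ^ x * (W * W)) (W ^ x * W) (W ^ x * V)
    ≡⟨ gcd3[c*m²,c*m,c*n]≡c (W ^ x) W V (n∣1+m⇒gcd[m,n]≡1 V∣1+W) ⟩
  W ^ x ∎
  where
  open ≡-Reasoning
  V∣1+W : V ∣ suc W
  V∣1+W = subst (V ∣_) (sym 1+W≡V^[x+2]) (m∣m^[n+2] V x)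

pegg-min : ∀ x V W → 2 ≤ V → suc W ≡ V ^ (x + 2) → min3 (W ^ (x + 2)) (W ^ (x + 1)) (W ^ x * V) ≡ W ^ x * V
pegg-min x V W 2≤V 1+W≡V^[x+2] = begin
  min3 (W ^ (x + 2)) (W ^ (x + 1)) (W ^ x * V)
    ≡⟨ cong₂ (λ a b → min3 a b (W ^ x * V)) (m^[n+2]≡m^n*[m*m] W x) (m^[n+1]≡m^n*m W x) ⟩
  min3 (W ^ x * (W * W)) (W ^ x * W) (W ^ x * V)
    ≡⟨ min3-of-decreasing (*-monoʳ-≤ (W ^ x) W≤W*W) (*-monoʳ-≤ (W ^ x) (<⇒≤ V<W)) ⟩
  W ^ x * V ∎
  where
  open ≡-Reasoning
  V<W : V < W
  V<W = 1+W≡V^[n+2]⇒V<W x 2≤V 1+W≡V^[x+2]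
  W≤W*W : W ≤ W * W
  W≤W*W = m≤m*n W W {{≢-nonZero (m<n⇒n≢0 V<W)}}

pegg-value : ∀ x V W → 2 ≤ V → suc W ≡ V ^ (x + 2) → peggValue (W ^ (x + 2)) (W ^ (x + 1)) (W ^ x * V) ≡ V
pegg-value x V W 2≤V 1+W≡V^[x+2] = trans
  (cong₂ _div_ (pegg-min x V W 2≤V 1+W≡V^[x+2]) (pegg-gcd x V W 1+W≡V^[x+2]))
  ([m*n]div[m]≡n (W ^ x) V {{m^n≢0 W x}})
  where
  instance
    W≢0 : NonZero W
    W≢0 = ≢-nonZero (m<n⇒n≢0 (1+W≡V^[n+2]⇒V<W x 2≤V 1+W≡V^[x+2]))

pegg-isSolution : ∀ x V W → 3 ≤ x → 2 ≤ V → suc W ≡ V ^ (x + 2) →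
  IsSolution (W ^ (x + 2)) (W ^ (x + 1)) (W ^ x * V) x (x + 1) (x + 2)
pegg-isSolution x V W 3≤x 2≤V 1+W≡V^[x+2] =
    (m^n>0 W (x + 2) , m^n>0 W (x + 1) , *-mono-≤ (m^n>0 W x) (<⇒≤ 2≤V))
  , (3≤x , ≤-trans 3≤x (m≤m+n x 1) , ≤-trans 3≤x (m≤m+n x 2))
  , pegg-equation x V W 1+W≡V^[x+2]
  where
  instance
    W≢0 : NonZero W
    W≢0 = ≢-nonZero (m<n⇒n≢0 (1+W≡V^[n+2]⇒V<W x 2≤V 1+W≡V^[x+2]))

pegg-triple : ∀ x V W → 1 ≤ x → 2 ≤ V → suc W ≡ V ^ (x + 2) →
  let A = W ^ (x + 2)
      B = W ^ (x + 1)
      C = W ^ x * V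
  in (A ^ x + B ^ (x + 1) ≡ C ^ (x + 2)) × (gcd3 A B C ≡ W ^ x) × (1 < W ^ x) × (peggValue A B C ≡ V)
pegg-triple x V W 1≤x 2≤V 1+W≡V^[x+2] =
    pegg-equation x V W 1+W≡V^[x+2]
  , pegg-gcd x V W 1+W≡V^[x+2]
  , ^-monoʳ-< W (<-trans 2≤V (1+W≡V^[n+2]⇒V<W x 2≤V 1+W≡V^[x+2])) 1≤x
  , pegg-value x V W 2≤V 1+W≡V^[x+2]

1+[m^n∸1]≡m^n : ∀ {m} n → 1 ≤ m → suc (m ^ n ∸ 1) ≡ m ^ n
1+[m^n∸1]≡m^n {m@(suc _)} n _ = m+[n∸m]≡n (m^n>0 m n)

pegg-value-unbounded : ∀ p → ∃[ A ] ∃[ B ] ∃[ C ] ∃[ x ] ∃[ y ] ∃[ z ] (IsSolution A B C x y z × p < peggValue A B C)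
pegg-value-unbounded p = _ , _ , _ , _ , _ , _
  , pegg-isSolution 3 V W ≤-refl 2≤V 1+W≡V^5
  , subst (p <_) (sym (pegg-value 3 V W 2≤V 1+W≡V^5)) (m<n+m p (s≤s z≤n))
  where
  V W : ℕ
  V = 2 + p
  W = V ^ 5 ∸ 1
  2≤V : 2 ≤ V
  2≤V = m≤m+n 2 p
  1+W≡V^5 : suc W ≡ V ^ 5
  1+W≡V^5 = 1+[m^n∸1]≡m^n {V} 5 (s≤s z≤n)

mainTheorem1 :
    (∀ (x V : ℕ) → 3 ≤ x → 2 ≤ V →
      let W = V ^ (x + 2) ∸ 1
          A = W ^ (x + 2)
          B = W ^ (x + 1)
          C = W ^ x * V
      in (A ^ x + B ^ (x + 1) ≡ C ^ (x + 2))
         × (gcd3 A B C ≡ W ^ x) × (1 < W ^ x)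
         × (peggValue A B C ≡ V))
    × (∀ (A B C x y z : ℕ) → IsSolution A B C x y z →
        ∃[ A' ] ∃[ B' ] ∃[ C' ] ∃[ x' ] ∃[ y' ] ∃[ z' ]
          (IsSolution A' B' C' x' y' z' × peggValue A B C < peggValue A' B' C'))
mainTheorem1 =
    (λ x V 3≤x 2≤V → pegg-triple x V _ (≤-trans (s≤s z≤n) 3≤x) 2≤V (1+[m^n∸1]≡m^n (x + 2) (<⇒≤ 2≤V)))
  , λ A B C _ _ _ _ → pegg-value-unbounded (peggValue A B C)
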